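{- Let $n \geq 1$. Approval ballot triangles of size $n$ are in bijection with approval ballot sequences of length $n$.
   Context: An approval ballot triangle (ABT) of size $n$ is a triangular array $A(i,j)$, $1 \leq j \leq i \leq n$, with entries in $\{0,1\}$ such that $\sum_{k=j}^{i} A(i,k) \leq \sum_{k=j}^{i+1} A(i+1,k)$ for all $1 \leq j \leq i \leq n-1$. An approval ballot sequence of length $n$ is a sequence of sets $B_1, B_2, \dots, B_n$ with $B_k \subseteq \{1,\dots,k\}$ such that for every $1 \leq s \leq n$ and $1 \leq t \leq n-1$, the number of indices $k \le s$ with $t \in B_k$ is at least the number of indices $k \le s$ with $t+1 \in B_k$. -}

module Defs where

open import Data.Bool using (Bool; true; false; if_then_else_)
open import Data.Nat using (ℕ; zero; suc; _+_; _∸_; _≤_; _≡ᵇ_)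
open import Data.Vec using (Vec; []; _∷_)
open import Data.List using (map; applyUpTo)
open import Data.Nat.ListAction using (sum)
open import Data.Unit using (⊤)
open import Data.Product using (Σ; _×_)
open import Data.Fin.Subset using (Subset)

⟦_⟧ : Bool → ℕ
⟦ true ⟧ = 1
⟦ false ⟧ = 0

-- the j-th entry (1-indexed) of a Boolean vector, as 0/1; 0 outside 1..m
bit : ∀ {m} → Vec Bool m → ℕ → ℕ
bit [] j = 0
bit (b ∷ bs) zero = 0
bit (b ∷ bs) (suc zero) = ⟦ b ⟧
bit (b ∷ bs) (suc (suc j)) = bit bs (suc j)

-- Σ_{k=a}^{b} f k  (empty sum if b < a)
sumFT : ℕ → ℕ → (ℕ → ℕ) → ℕ
sumFT a b f = sum (map f (applyUpTo (a +_) (suc b ∸ a)))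

-- A triangular array of Booleans with rows 1..n, row i having i entries.
-- Tri (suc n) = (rows 1..n) × (row n+1).
Tri : ℕ → Set
Tri zero = ⊤
Tri (suc n) = Tri n × Vec Bool (suc n)

-- entry A(i,j) as 0/1 (1-indexed); 0 outside 1 ≤ j ≤ i ≤ n
entry : ∀ {n} → Tri n → ℕ → ℕ → ℕ
entry {zero} _ i j = 0
entry {suc n} (t Data.Product., r) i j =
  if i ≡ᵇ suc n then bit r j else entry t i j

IsABT : (n : ℕ) → Tri n → Set
IsABT n A = ∀ i j → 1 ≤ j → j ≤ i → i ≤ n ∸ 1 →
  sumFT j i (entry A i) ≤ sumFT j (suc i) (entry A (suc i))

ApprovalBallotTriangle : ℕ → Set
ApprovalBallotTriangle n = Σ (Tri n) (IsABT n)

-- A sequence B_1, …, B_n with B_k ⊆ {1,…,k}, each B_k a Subset k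
-- (Vec Bool k, position j true iff j ∈ B_k).
SetSeq : ℕ → Set
SetSeq zero = ⊤
SetSeq (suc n) = SetSeq n × Subset (suc n)

-- [t ∈ B_k] as 0/1 (1-indexed k and t)
mem : ∀ {n} → SetSeq n → ℕ → ℕ → ℕ
mem {zero} _ k t = 0
mem {suc n} (b Data.Product., B) k t =
  if k ≡ᵇ suc n then bit B t else mem b k t

count : ∀ {n} → SetSeq n → ℕ → ℕ → ℕ
count B s t = sumFT 1 s (λ k → mem B k t)

IsABS : (n : ℕ) → SetSeq n → Set
IsABS n B = ∀ s t → 1 ≤ s → s ≤ n → 1 ≤ t → t ≤ n ∸ 1 →
  count B s (suc t) ≤ count B s t

ApprovalBallotSequence : ℕ → Set
ApprovalBallotSequence n = Σ (SetSeq n) (IsABS n)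

-- Read a sequence B₁ … Bₙ as the triangle T(k,t) = [t ∈ Bₖ]; then #{k ≤ s : t ∈ Bₖ} is the
-- prefix sum of column t of T down to row s.  Mirror T in its anti-diagonal,
-- U(i,j) = T(n+1-j, n+1-i).  As T vanishes above the diagonal, the column prefix sum
-- Σ_{k≤s} T(k,t) becomes the row suffix sum Σ_{k=n+1-s}^{n+1-t} U(n+1-t,k).  So for t < s the
-- ballot condition comparing columns t+1 and t up to row s is exactly the triangle condition
-- comparing rows n-t and n+1-t from column n+1-s; for s ≤ t it is trivial, column t+1 being
-- zero up to row s.  The mirroring is an involution, hence the bijection.

module Submission where

open import Defs
open import Data.Nat using (ℕ; zero; suc; _+_; _∸_; _≤_; _<_; _≡ᵇ_; z≤n; s≤s; z<s; s<s; _≟_; _≤?_)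
open import Data.Nat.Properties
open import Data.Nat.ListAction using (sum)
open import Data.Nat.ListAction.Properties using (sum-++)
open import Data.Nat.Tactic.RingSolver using (solve-∀)
open import Data.Bool using (Bool; true; false)
open import Data.Vec using (Vec; []; _∷_)
open import Data.List using ([_]; _∷ʳ_; applyUpTo)
open import Data.List.Properties using (applyUpTo-∷ʳ; map-applyUpTo; map-cong)
open import Data.Unit using (tt)
open import Data.Product using (Σ; _×_; _,_; proj₁)
open import Function using (_∘_)
open import Relation.Nullary using (yes; no; contradiction)
open import Relation.Binary.PropositionalEquality
  using (_≡_; _≢_; refl; sym; trans; cong; cong₂; subst; subst₂; module ≡-Reasoning)

sum-applyUpTo-suc : ∀ (g : ℕ → ℕ) L → sum (applyUpTo g (suc L)) ≡ sum (applyUpTo g L) + g L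
sum-applyUpTo-suc g L = begin
  sum (applyUpTo g (suc L))       ≡⟨ cong sum (applyUpTo-∷ʳ g L) ⟨
  sum (applyUpTo g L ∷ʳ g L)      ≡⟨ sum-++ (applyUpTo g L) [ g L ] ⟩
  sum (applyUpTo g L) + (g L + 0) ≡⟨ cong (sum (applyUpTo g L) +_) (+-identityʳ (g L)) ⟩
  sum (applyUpTo g L) + g L       ∎
  where open ≡-Reasoning

sum-applyUpTo-+ : ∀ (g : ℕ → ℕ) L M →
  sum (applyUpTo g (L + M)) ≡ sum (applyUpTo g L) + sum (applyUpTo (λ m → g (L + m)) M)
sum-applyUpTo-+ g zero    M = refl
sum-applyUpTo-+ g (suc L) M =
  trans (cong (g 0 +_) (sum-applyUpTo-+ (g ∘ suc) L M)) (sym (+-assoc (g 0) _ _))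

sum-applyUpTo-cong : ∀ L {g h : ℕ → ℕ} → (∀ {m} → m < L → g m ≡ h m) →
  sum (applyUpTo g L) ≡ sum (applyUpTo h L)
sum-applyUpTo-cong zero    g≗h = refl
sum-applyUpTo-cong (suc L) g≗h = cong₂ _+_ (g≗h z<s) (sum-applyUpTo-cong L (g≗h ∘ s<s))

sum-applyUpTo-≡0 : ∀ L {g : ℕ → ℕ} → (∀ {m} → m < L → g m ≡ 0) → sum (applyUpTo g L) ≡ 0
sum-applyUpTo-≡0 zero    g≗0 = refl
sum-applyUpTo-≡0 (suc L) g≗0 = cong₂ _+_ (g≗0 z<s) (sum-applyUpTo-≡0 L (g≗0 ∘ s<s))

sum-applyUpTo-reverse : ∀ L {g h : ℕ → ℕ} → (∀ {m m'} → suc (m + m') ≡ L → g m ≡ h m') →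
  sum (applyUpTo g L) ≡ sum (applyUpTo h L)
sum-applyUpTo-reverse zero    g~h = refl
sum-applyUpTo-reverse (suc L) {g} {h} g~h = begin
  sum (applyUpTo g (suc L))  ≡⟨ sum-applyUpTo-suc g L ⟩
  sum (applyUpTo g L) + g L  ≡⟨ +-comm _ (g L) ⟩
  g L + sum (applyUpTo g L)  ≡⟨ cong₂ _+_ (g~h (cong suc (+-identityʳ L)))
                                         (sum-applyUpTo-reverse L (g~h ∘ cong suc ∘ shift)) ⟩
  h 0 + sum (applyUpTo (h ∘ suc) L) ∎
  where
  open ≡-Reasoning
  shift : ∀ {m m'} → suc (m + m') ≡ L → m + suc m' ≡ L
  shift {m} {m'} e = trans (+-suc m m') e

sumFT-applyUpTo : ∀ a L {b} (f : ℕ → ℕ) → a + L ≡ suc b →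
  sumFT a b f ≡ sum (applyUpTo (λ m → f (a + m)) L)
sumFT-applyUpTo a L {b} f a+L≡1+b = begin
  sumFT a b f                                    ≡⟨ cong sum (map-applyUpTo (a +_) f (suc b ∸ a)) ⟩
  sum (applyUpTo (λ m → f (a + m)) (suc b ∸ a))  ≡⟨ cong (sum ∘ applyUpTo _) length≡L ⟩
  sum (applyUpTo (λ m → f (a + m)) L)            ∎
  where
  open ≡-Reasoning
  length≡L : suc b ∸ a ≡ L
  length≡L = trans (cong (_∸ a) (sym a+L≡1+b)) (m+n∸m≡n a L)

sumFT-skipZeros : ∀ {a b c} (f : ℕ → ℕ) → a ≤ c → c ≤ suc b → (∀ {k} → k < c → f k ≡ 0) →
  sumFT a b f ≡ sumFT c b f
sumFT-skipZeros {a} {b} f a≤c c≤1+b f≗0 with m≤n⇒∃[o]m+o≡n a≤c | m≤n⇒∃[o]m+o≡n c≤1+b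
... | L , refl | M , c+M≡1+b = begin
  sumFT a b f
    ≡⟨ sumFT-applyUpTo a (L + M) f (trans (sym (+-assoc a L M)) c+M≡1+b) ⟩
  sum (applyUpTo (λ m → f (a + m)) (L + M))
    ≡⟨ sum-applyUpTo-+ _ L M ⟩
  sum (applyUpTo (λ m → f (a + m)) L) + sum (applyUpTo (λ m → f (a + (L + m))) M)
    ≡⟨ cong₂ _+_ (sum-applyUpTo-≡0 L (f≗0 ∘ +-monoʳ-< a))
                 (sum-applyUpTo-cong M (λ {m} _ → cong f (sym (+-assoc a L m)))) ⟩
  sum (applyUpTo (λ m → f (a + L + m)) M)
    ≡⟨ sumFT-applyUpTo (a + L) M f c+M≡1+b ⟨
  sumFT (a + L) b f ∎
  where open ≡-Reasoning

-- The reindexing k ↦ c ∸ k, written without subtraction.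
sumFT-reflect : ∀ {a b a' b' c} (f g : ℕ → ℕ) → a + b' ≡ c → b + a' ≡ c → a ≤ suc b →
  (∀ {k k'} → k + k' ≡ c → a ≤ k → k ≤ b → f k ≡ g k') → sumFT a b f ≡ sumFT a' b' g
sumFT-reflect {a} {b} {a'} {b'} {c} f g a+b'≡c b+a'≡c a≤1+b f~g = begin
  sumFT a b f                            ≡⟨ sumFT-applyUpTo a L f a+L≡1+b ⟩
  sum (applyUpTo (λ m → f (a + m)) L)    ≡⟨ sum-applyUpTo-reverse L pointwise ⟩
  sum (applyUpTo (λ m → g (a' + m)) L)   ≡⟨ sumFT-applyUpTo a' L g a'+L≡1+b' ⟨
  sumFT a' b' g                          ∎
  where
  open ≡-Reasoning
  L = suc b ∸ a
  a+L≡1+b : a + L ≡ suc b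
  a+L≡1+b = m+[n∸m]≡n a≤1+b
  a+L+a'≡1+c : a + L + a' ≡ suc c
  a+L+a'≡1+c = trans (cong (_+ a') a+L≡1+b) (cong suc b+a'≡c)
  a'+L≡1+b' : a' + L ≡ suc b'
  a'+L≡1+b' = +-cancelˡ-≡ a _ _ (begin
    a + (a' + L)  ≡⟨ cong (a +_) (+-comm a' L) ⟩
    a + (L + a')  ≡⟨ +-assoc a L a' ⟨
    a + L + a'    ≡⟨ a+L+a'≡1+c ⟩
    suc c         ≡⟨ cong suc a+b'≡c ⟨
    suc (a + b')  ≡⟨ +-suc a b' ⟨
    a + suc b'    ∎)
  regroup : ∀ x y z w → suc (x + y + (z + w)) ≡ x + suc (y + w) + z
  regroup = solve-∀
  pointwise : ∀ {m m'} → suc (m + m') ≡ L → f (a + m) ≡ g (a' + m')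
  pointwise {m} {m'} 1+m+m'≡L = f~g (suc-injective (begin
      suc (a + m + (a' + m'))  ≡⟨ regroup a m a' m' ⟩
      a + suc (m + m') + a'    ≡⟨ cong (λ x → a + x + a') 1+m+m'≡L ⟩
      a + L + a'               ≡⟨ a+L+a'≡1+c ⟩
      suc c                    ∎))
    (m≤m+n a m) (≤-pred (subst (suc (a + m) ≤_) a+L≡1+b a+m<a+L))
    where
    a+m<a+L : a + m < a + L
    a+m<a+L = +-monoʳ-< a (subst (m <_) 1+m+m'≡L (s≤s (m≤m+n m m')))

⟦⟧-injective : ∀ {b b'} → ⟦ b ⟧ ≡ ⟦ b' ⟧ → b ≡ b'
⟦⟧-injective {true}  {true}  _ = refl
⟦⟧-injective {false} {false} _ = refl

bitᵇ : ∀ {m} → Vec Bool m → ℕ → Bool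
bitᵇ []       _             = false
bitᵇ (_ ∷ _)  zero          = false
bitᵇ (b ∷ _)  (suc zero)    = b
bitᵇ (_ ∷ bs) (suc (suc j)) = bitᵇ bs (suc j)

bit≡⟦bitᵇ⟧ : ∀ {m} (r : Vec Bool m) j → bit r j ≡ ⟦ bitᵇ r j ⟧
bit≡⟦bitᵇ⟧ []       _             = refl
bit≡⟦bitᵇ⟧ (_ ∷ _)  zero          = refl
bit≡⟦bitᵇ⟧ (_ ∷ _)  (suc zero)    = refl
bit≡⟦bitᵇ⟧ (_ ∷ bs) (suc (suc j)) = bit≡⟦bitᵇ⟧ bs (suc j)

bit-outside : ∀ {m} (r : Vec Bool m) {j} → m < j → bit r j ≡ 0
bit-outside []       _                         = refl
bit-outside (_ ∷ _)  {suc zero}    (s≤s ())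
bit-outside (_ ∷ bs) {suc (suc j)} (s≤s m<1+j) = bit-outside bs m<1+j

bit-ext : ∀ {m} {r r' : Vec Bool m} → (∀ {j} → 1 ≤ j → j ≤ m → bit r j ≡ bit r' j) → r ≡ r'
bit-ext {r = []}    {[]}    _    = refl
bit-ext {r = _ ∷ _} {_ ∷ _} r≗r' =
  cong₂ _∷_ (⟦⟧-injective (r≗r' z<s (s≤s z≤n)))
            (bit-ext λ { {suc j} _ j≤m → r≗r' z<s (s≤s j≤m) })

tabulateRow : (m : ℕ) → (ℕ → Bool) → Vec Bool m
tabulateRow zero    _ = []
tabulateRow (suc m) h = h 1 ∷ tabulateRow m (h ∘ suc)

bit-tabulateRow : ∀ m h {j} → 1 ≤ j → j ≤ m → bit (tabulateRow m h) j ≡ ⟦ h j ⟧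
bit-tabulateRow (suc m) h {suc zero}    _ _           = refl
bit-tabulateRow (suc m) h {suc (suc j)} _ (s≤s j<m) = bit-tabulateRow m (h ∘ suc) z<s j<m

InTriangle : ℕ → ℕ → ℕ → Set
InTriangle n i j = 1 ≤ j × j ≤ i × i ≤ n

entry-top : ∀ {n} (A : Tri n) (r : Vec Bool (suc n)) j → entry (A , r) (suc n) j ≡ bit r j
entry-top {n} _ _ _ with n ≡ᵇ n | ≡⇒≡ᵇ n n refl
... | true | _ = refl

entry-below : ∀ {n} (A : Tri n) (r : Vec Bool (suc n)) {i} j → i ≢ suc n →
  entry (A , r) i j ≡ entry A i j
entry-below {n} _ _ {i} _ i≢1+n with i ≡ᵇ suc n | ≡ᵇ⇒≡ i (suc n)
... | false | _       = refl
... | true  | i≡1+n = contradiction (i≡1+n tt) i≢1+n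

entry-upper : ∀ {n} (A : Tri n) {i j} → i < j → entry A i j ≡ 0
entry-upper {zero}  _       _   = refl
entry-upper {suc n} (A , r) {i} {j} i<j with i ≟ suc n
... | yes refl  = trans (entry-top A r j) (bit-outside r i<j)
... | no i≢1+n = trans (entry-below A r j i≢1+n) (entry-upper A i<j)

entryᵇ : ∀ {n} → Tri n → ℕ → ℕ → Bool
entryᵇ {zero}  _       _ _ = false
entryᵇ {suc n} (A , r) i j with i ≡ᵇ suc n
... | true  = bitᵇ r j
... | false = entryᵇ A i j

entry≡⟦entryᵇ⟧ : ∀ {n} (A : Tri n) i j → entry A i j ≡ ⟦ entryᵇ A i j ⟧
entry≡⟦entryᵇ⟧ {zero}  _       _ _ = refl
entry≡⟦entryᵇ⟧ {suc n} (A , r) i j with i ≡ᵇ suc n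
... | true  = bit≡⟦bitᵇ⟧ r j
... | false = entry≡⟦entryᵇ⟧ A i j

tabulateTri : (n : ℕ) → (ℕ → ℕ → Bool) → Tri n
tabulateTri zero    _ = tt
tabulateTri (suc n) g = tabulateTri n g , tabulateRow (suc n) (g (suc n))

entry-tabulateTri : ∀ n g {i j} → InTriangle n i j → entry (tabulateTri n g) i j ≡ ⟦ g i j ⟧
entry-tabulateTri zero    g (s≤s _ , s≤s _ , ())
entry-tabulateTri (suc n) g {i} {j} (1≤j , j≤i , i≤1+n) with i ≟ suc n
... | yes refl  = trans (entry-top (tabulateTri n g) (tabulateRow (suc n) (g (suc n))) j)
                       (bit-tabulateRow (suc n) (g (suc n)) 1≤j j≤i)
... | no i≢1+n = trans (entry-below (tabulateTri n g) (tabulateRow (suc n) (g (suc n))) j i≢1+n)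
                       (entry-tabulateTri n g (1≤j , j≤i , ≤-pred (≤∧≢⇒< i≤1+n i≢1+n)))

Tri-ext : ∀ {n} {A A' : Tri n} → (∀ {i j} → InTriangle n i j → entry A i j ≡ entry A' i j) →
  A ≡ A'
Tri-ext {zero}                        _     = refl
Tri-ext {suc n} {A , r} {A' , r'} A≗A' = cong₂ _,_ (Tri-ext lower) (bit-ext top)
  where
  lower : ∀ {i j} → InTriangle n i j → entry A i j ≡ entry A' i j
  lower {i} {j} (1≤j , j≤i , i≤n) = begin
    entry A i j         ≡⟨ entry-below A r j i≢1+n ⟨
    entry (A , r) i j   ≡⟨ A≗A' (1≤j , j≤i , m≤n⇒m≤1+n i≤n) ⟩
    entry (A' , r') i j ≡⟨ entry-below A' r' j i≢1+n ⟩
    entry A' i j        ∎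
    where
    open ≡-Reasoning
    i≢1+n = <⇒≢ (s≤s i≤n)
  top : ∀ {j} → 1 ≤ j → j ≤ suc n → bit r j ≡ bit r' j
  top {j} 1≤j j≤1+n = trans (sym (entry-top A r j))
                             (trans (A≗A' (1≤j , j≤1+n , ≤-refl)) (entry-top A' r' j))

InTriangle-reflect : ∀ {n i j i' j'} → i + j' ≡ suc n → j + i' ≡ suc n →
  InTriangle n i j → InTriangle n i' j'
InTriangle-reflect {n} {i} {j} {i'} {j'} i+j'≡1+n j+i'≡1+n (1≤j , j≤i , i≤n) =
  1≤j' , j'≤i' , ≤-pred 1+i'≤1+n
  where
  open ≤-Reasoning
  1≤j' : 1 ≤ j'
  1≤j' = +-cancelˡ-≤ i 1 j' (begin
    i + 1   ≡⟨ +-comm i 1 ⟩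
    suc i   ≤⟨ s≤s i≤n ⟩
    suc n   ≡⟨ i+j'≡1+n ⟨
    i + j'  ∎)
  j'≤i' : j' ≤ i'
  j'≤i' = +-cancelˡ-≤ j j' i' (begin
    j + j'  ≤⟨ +-monoˡ-≤ j' j≤i ⟩
    i + j'  ≡⟨ trans i+j'≡1+n (sym j+i'≡1+n) ⟩
    j + i'  ∎)
  1+i'≤1+n : suc i' ≤ suc n
  1+i'≤1+n = begin
    1 + i'  ≤⟨ +-monoˡ-≤ i' 1≤j ⟩
    j + i'  ≡⟨ j+i'≡1+n ⟩
    suc n   ∎

Reflected : (n : ℕ) → Tri n → Tri n → Set
Reflected n T U = ∀ {i j i' j'} → i + j' ≡ suc n → j + i' ≡ suc n → InTriangle n i j →
  entry T i j ≡ entry U i' j'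

Reflected-sym : ∀ {n T U} → Reflected n T U → Reflected n U T
Reflected-sym T~U {i} {j} {i'} {j'} i+j'≡1+n j+i'≡1+n ij =
  sym (T~U (trans (+-comm i' j) j+i'≡1+n) (trans (+-comm j' i) i+j'≡1+n)
           (InTriangle-reflect i+j'≡1+n j+i'≡1+n ij))

reflect : (n : ℕ) → Tri n → Tri n
reflect n A = tabulateTri n (λ i j → entryᵇ A (suc n ∸ j) (suc n ∸ i))

reflect-reflected : ∀ n A → Reflected n A (reflect n A)
reflect-reflected n A {i} {j} {i'} {j'} i+j'≡1+n j+i'≡1+n ij = sym (begin
  entry (reflect n A) i' j'
    ≡⟨ entry-tabulateTri n _ (InTriangle-reflect i+j'≡1+n j+i'≡1+n ij) ⟩
  ⟦ entryᵇ A (suc n ∸ j') (suc n ∸ i') ⟧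
    ≡⟨ entry≡⟦entryᵇ⟧ A _ _ ⟨
  entry A (suc n ∸ j') (suc n ∸ i')
    ≡⟨ cong₂ (entry A) (∸-complement i+j'≡1+n) (∸-complement j+i'≡1+n) ⟩
  entry A i j ∎)
  where
  open ≡-Reasoning
  ∸-complement : ∀ {x y} → x + y ≡ suc n → suc n ∸ y ≡ x
  ∸-complement {x} {y} x+y≡1+n = trans (cong (_∸ y) (sym x+y≡1+n)) (m+n∸n≡m x y)

reflect-involutive : ∀ n A → reflect n (reflect n A) ≡ A
reflect-involutive n A = Tri-ext λ {i} {j} ij@(_ , j≤i , i≤n) →
  let i+j'≡1+n = m+[n∸m]≡n (m≤n⇒m≤1+n i≤n)
      j+i'≡1+n = m+[n∸m]≡n (m≤n⇒m≤1+n (≤-trans j≤i i≤n))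
  in trans (Reflected-sym (reflect-reflected n (reflect n A)) i+j'≡1+n j+i'≡1+n ij)
           (sym (reflect-reflected n A i+j'≡1+n j+i'≡1+n ij))

columnPrefixSum : ∀ {n} → Tri n → ℕ → ℕ → ℕ
columnPrefixSum T s t = sumFT 1 s (λ k → entry T k t)

rowSuffixSum : ∀ {n} → Tri n → ℕ → ℕ → ℕ
rowSuffixSum U i j = sumFT j i (entry U i)

columnPrefixSum-upper : ∀ {n} (T : Tri n) {s t} → s < t → columnPrefixSum T s t ≡ 0
columnPrefixSum-upper T {s} {t} s<t =
  trans (sumFT-applyUpTo 1 s _ refl)
        (sum-applyUpTo-≡0 s (λ m<s → entry-upper T (≤-trans (s≤s m<s) s<t)))

columnPrefixSum≡rowSuffixSum : ∀ {n T U s t i j} → Reflected n T U →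
  s + j ≡ suc n → t + i ≡ suc n → InTriangle n s t →
  columnPrefixSum T s t ≡ rowSuffixSum U i j
columnPrefixSum≡rowSuffixSum {n} {T} {U} {s} {t} {i} {j} T~U s+j≡1+n t+i≡1+n (1≤t , t≤s , s≤n) =
  begin
  sumFT 1 s (λ k → entry T k t) ≡⟨ sumFT-skipZeros _ 1≤t t≤1+s (entry-upper T) ⟩
  sumFT t s (λ k → entry T k t) ≡⟨ sumFT-reflect _ _ t+i≡1+n s+j≡1+n t≤1+s reflected ⟩
  sumFT j i (entry U i)         ∎
  where
  open ≡-Reasoning
  t≤1+s = m≤n⇒m≤1+n t≤s
  reflected : ∀ {k k'} → k + k' ≡ suc n → t ≤ k → k ≤ s → entry T k t ≡ entry U i k'
  reflected k+k'≡1+n t≤k k≤s = T~U k+k'≡1+n t+i≡1+n (1≤t , t≤k , ≤-trans k≤s s≤n)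

toTri : ∀ {n} → SetSeq n → Tri n
toTri {zero}  _       = tt
toTri {suc n} (B , b) = toTri B , b

fromTri : ∀ {n} → Tri n → SetSeq n
fromTri {zero}  _       = tt
fromTri {suc n} (A , r) = fromTri A , r

toTri-fromTri : ∀ {n} (A : Tri n) → toTri (fromTri A) ≡ A
toTri-fromTri {zero}  _       = refl
toTri-fromTri {suc n} (A , r) = cong (_, r) (toTri-fromTri A)

fromTri-toTri : ∀ {n} (B : SetSeq n) → fromTri (toTri B) ≡ B
fromTri-toTri {zero}  _       = refl
fromTri-toTri {suc n} (B , b) = cong (_, b) (fromTri-toTri B)

mem≡entry : ∀ {n} (B : SetSeq n) k t → mem B k t ≡ entry (toTri B) k t
mem≡entry {zero}  _       _ _ = refl
mem≡entry {suc n} (B , b) k t with k ≡ᵇ suc n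
... | true  = refl
... | false = mem≡entry B k t

count≡columnPrefixSum : ∀ {n} (B : SetSeq n) s t → count B s t ≡ columnPrefixSum (toTri B) s t
count≡columnPrefixSum B s t = cong sum (map-cong (λ k → mem≡entry B k t) (applyUpTo (1 +_) s))

ColumnBallot : (n : ℕ) → Tri n → Set
ColumnBallot n T = ∀ s t → 1 ≤ s → s ≤ n → 1 ≤ t → t ≤ n ∸ 1 →
  columnPrefixSum T s (suc t) ≤ columnPrefixSum T s t

IsABS⇒ColumnBallot : ∀ {n} {B : SetSeq n} → IsABS n B → ColumnBallot n (toTri B)
IsABS⇒ColumnBallot {B = B} abs s t 1≤s s≤n 1≤t t≤n∸1 =
  subst₂ _≤_ (count≡columnPrefixSum B s (suc t)) (count≡columnPrefixSum B s t)
             (abs s t 1≤s s≤n 1≤t t≤n∸1)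

ColumnBallot⇒IsABS : ∀ {n} {B : SetSeq n} → ColumnBallot n (toTri B) → IsABS n B
ColumnBallot⇒IsABS {B = B} cb s t 1≤s s≤n 1≤t t≤n∸1 =
  subst₂ _≤_ (sym (count≡columnPrefixSum B s (suc t))) (sym (count≡columnPrefixSum B s t))
             (cb s t 1≤s s≤n 1≤t t≤n∸1)

m≤n∸1⇒m<n : ∀ {m n} → 1 ≤ m → m ≤ n ∸ 1 → m < n
m≤n∸1⇒m<n {n = zero}  (s≤s _) ()
m≤n∸1⇒m<n {n = suc n} _       m≤n = s≤s m≤n

IsABT-step : ∀ {n U i j} → IsABT n U → InTriangle n i j → InTriangle n (suc i) j →
  rowSuffixSum U i j ≤ rowSuffixSum U (suc i) j
IsABT-step abt (1≤j , j≤i , _) (_ , _ , 1+i≤n) = abt _ _ 1≤j j≤i (∸-monoˡ-≤ 1 1+i≤n)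

ColumnBallot-step : ∀ {n T s t} → ColumnBallot n T → InTriangle n s (suc t) → InTriangle n s t →
  columnPrefixSum T s (suc t) ≤ columnPrefixSum T s t
ColumnBallot-step cb (_ , 1+t≤s , s≤n) (1≤t , t≤s , _) =
  cb _ _ (≤-trans 1≤t t≤s) s≤n 1≤t (∸-monoˡ-≤ 1 (≤-trans 1+t≤s s≤n))

IsABT⇒ColumnBallot : ∀ {n T U} → Reflected n T U → IsABT n U → ColumnBallot n T
IsABT⇒ColumnBallot {n} {T} {U} T~U abt s t _ s≤n 1≤t _ with s ≤? t
... | yes s≤t = subst (_≤ columnPrefixSum T s t) (sym (columnPrefixSum-upper T (s≤s s≤t))) z≤n
... | no s≰t = begin
  columnPrefixSum T s (suc t) ≡⟨ columnPrefixSum≡rowSuffixSum T~U s+j≡1+n 1+t+i≡1+n s,1+t ⟩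
  rowSuffixSum U i j          ≤⟨ IsABT-step abt (InTriangle-reflect s+j≡1+n 1+t+i≡1+n s,1+t)
                                                (InTriangle-reflect s+j≡1+n t+1+i≡1+n s,t) ⟩
  rowSuffixSum U (suc i) j    ≡⟨ columnPrefixSum≡rowSuffixSum T~U s+j≡1+n t+1+i≡1+n s,t ⟨
  columnPrefixSum T s t       ∎
  where
  open ≤-Reasoning
  1+t≤s = ≰⇒> s≰t
  s,1+t : InTriangle n s (suc t)
  s,1+t = z<s , 1+t≤s , s≤n
  s,t : InTriangle n s t
  s,t = 1≤t , <⇒≤ 1+t≤s , s≤n
  j = suc n ∸ s
  i = n ∸ t
  s+j≡1+n : s + j ≡ suc n
  s+j≡1+n = m+[n∸m]≡n (m≤n⇒m≤1+n s≤n)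
  1+t+i≡1+n : suc t + i ≡ suc n
  1+t+i≡1+n = cong suc (m+[n∸m]≡n (≤-trans (<⇒≤ 1+t≤s) s≤n))
  t+1+i≡1+n : t + suc i ≡ suc n
  t+1+i≡1+n = trans (+-suc t i) 1+t+i≡1+n

ColumnBallot⇒IsABT : ∀ {n T U} → Reflected n T U → ColumnBallot n T → IsABT n U
ColumnBallot⇒IsABT {n} {T} {U} T~U cb i j 1≤j j≤i i≤n∸1 = begin
  rowSuffixSum U i j           ≡⟨ columnPrefixSum≡rowSuffixSum T~U s+j≡1+n 1+t+i≡1+n s,1+t ⟨
  columnPrefixSum T s (suc t)  ≤⟨ ColumnBallot-step cb s,1+t s,t ⟩
  columnPrefixSum T s t        ≡⟨ columnPrefixSum≡rowSuffixSum T~U s+j≡1+n t+1+i≡1+n s,t ⟩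
  rowSuffixSum U (suc i) j     ∎
  where
  open ≤-Reasoning
  i<n : i < n
  i<n = m≤n∸1⇒m<n (≤-trans 1≤j j≤i) i≤n∸1
  j≤1+n : j ≤ suc n
  j≤1+n = ≤-trans j≤i (m<n⇒m≤1+n i<n)
  s = suc n ∸ j
  t = n ∸ i
  s+j≡1+n : s + j ≡ suc n
  s+j≡1+n = m∸n+n≡m j≤1+n
  1+t+i≡1+n : suc t + i ≡ suc n
  1+t+i≡1+n = cong suc (m∸n+n≡m (<⇒≤ i<n))
  t+1+i≡1+n : t + suc i ≡ suc n
  t+1+i≡1+n = trans (+-suc t i) 1+t+i≡1+n
  s,1+t : InTriangle n s (suc t)
  s,1+t = InTriangle-reflect (trans (+-comm i (suc t)) 1+t+i≡1+n) (m+[n∸m]≡n j≤1+n)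
                             (1≤j , j≤i , <⇒≤ i<n)
  s,t : InTriangle n s t
  s,t = InTriangle-reflect (trans (+-comm (suc i) t) t+1+i≡1+n) (m+[n∸m]≡n j≤1+n)
                           (1≤j , m≤n⇒m≤1+n j≤i , i<n)

toSequence : ∀ n → ApprovalBallotTriangle n → ApprovalBallotSequence n
toSequence n (A , abt) =
  fromTri (reflect n A) ,
  ColumnBallot⇒IsABS (subst (ColumnBallot n) (sym (toTri-fromTri (reflect n A)))
                            (IsABT⇒ColumnBallot (Reflected-sym (reflect-reflected n A)) abt))

toTriangle : ∀ n → ApprovalBallotSequence n → ApprovalBallotTriangle n
toTriangle n (B , abs) =
  reflect n (toTri B) , ColumnBallot⇒IsABT (reflect-reflected n (toTri B)) (IsABS⇒ColumnBallot abs)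

proposition2p1 : (n : ℕ) → 1 ≤ n →
    Σ (ApprovalBallotTriangle n → ApprovalBallotSequence n) λ f →
    Σ (ApprovalBallotSequence n → ApprovalBallotTriangle n) λ g →
      ((x : ApprovalBallotTriangle n) → proj₁ (g (f x)) ≡ proj₁ x) ×
      ((y : ApprovalBallotSequence n) → proj₁ (f (g y)) ≡ proj₁ y)
proposition2p1 n _ =
  toSequence n ,
  toTriangle n ,
  (λ (A , _) → trans (cong (reflect n) (toTri-fromTri (reflect n A))) (reflect-involutive n A)) ,
  (λ (B , _) → trans (cong fromTri (reflect-involutive n (toTri B))) (fromTri-toTri B))
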